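{- Every blowup of a chordal graph is recolorable.
   Context: Graphs are finite and simple. A graph is chordal if it has no induced cycle of length more than three. A blowup of a graph $G$ is a graph obtained from $G$ by substituting non-empty cliques for some of its vertices (substituting a clique $K$ for $v$ means deleting $v$ and adding $K$ with every vertex of $K$ adjacent to every former neighbor of $v$). A $k$-coloring of $G$ is a map $V(G)\to\{1,\dots,k\}$ giving adjacent vertices different colors; $\chi(G)$ is the chromatic number. $R_\ell(G)$ is the graph whose vertices are the $\ell$-colorings of $G$, two adjacent if they differ on exactly one vertex. $G$ is recolorable if $R_\ell(G)$ is connected for every $\ell\ge\chi(G)+1$. -}

module Defs where

open import Data.Nat using (ℕ; suc; _+_; _<_; _≤_)
open import Data.Nat.DivMod using (_%_)
open import Data.Fin using (Fin; toℕ)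
open import Data.Vec using (Vec; lookup)
open import Data.Bool using (Bool; T)
open import Data.Product using (Σ; ∃; _×_)
open import Data.Sum using (_⊎_)
open import Relation.Nullary using (¬_)
open import Relation.Binary.PropositionalEquality using (_≡_; _≢_)
open import Relation.Binary.Construct.Closure.ReflexiveTransitive using (Star)
open import Function.Definitions using (Injective; Surjective)

record Graph : Set where
  field
    n      : ℕ
    adj    : Fin n → Fin n → Bool
    sym    : ∀ u v → adj u v ≡ adj v u
    irrefl : ∀ v → adj v v ≡ Data.Bool.false

open Graph public

Adj : (G : Graph) → Fin (n G) → Fin (n G) → Set
Adj G u v = T (adj G u v)

CycNext : ∀ {k} → Fin k → Fin k → Set
CycNext {k} i j = toℕ j ≡ (toℕ i + 1) % suc (Data.Nat.pred k)

CycAdj : ∀ {k} → Fin k → Fin k → Set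
CycAdj i j = CycNext i j ⊎ CycNext j i

InducedCycle : (G : Graph) → ℕ → Set
InducedCycle G k =
  Σ (Fin k → Fin (n G)) λ c →
    Injective _≡_ _≡_ c ×
    (∀ i j → (Adj G (c i) (c j) → CycAdj i j) × (CycAdj i j → Adj G (c i) (c j)))

Chordal : Graph → Set
Chordal G = ∀ k → 3 < k → ¬ InducedCycle G k

-- H is a blowup of G: there is a surjection p : V(H) → V(G) whose fibres
-- are (non-empty) cliques, and distinct vertices of H in different fibres are
-- adjacent iff their images are adjacent in G.  (Vertices of G not
-- substituted correspond to singleton fibres.)
IsBlowupOf : Graph → Graph → Set
IsBlowupOf H G =
  Σ (Fin (n H) → Fin (n G)) λ p →
    Surjective _≡_ _≡_ p ×
    (∀ u v → u ≢ v →
      (Adj H u v → (p u ≡ p v ⊎ Adj G (p u) (p v))) ×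
      ((p u ≡ p v ⊎ Adj G (p u) (p v)) → Adj H u v))

-- A (not necessarily proper) assignment of colours {1..k} ≅ Fin k.
Assignment : Graph → ℕ → Set
Assignment G k = Vec (Fin k) (n G)

IsColoring : (G : Graph) {k : ℕ} → Assignment G k → Set
IsColoring G c = ∀ u v → Adj G u v → lookup c u ≢ lookup c v

Colorable : Graph → ℕ → Set
Colorable G k = ∃ λ (c : Assignment G k) → IsColoring G c

IsChromaticNumber : Graph → ℕ → Set
IsChromaticNumber G χ = Colorable G χ × (∀ k → k < χ → ¬ Colorable G k)

REdge : (G : Graph) (ℓ : ℕ) → Assignment G ℓ → Assignment G ℓ → Set
REdge G ℓ α β =
  IsColoring G α × IsColoring G β ×
  ∃ λ v → lookup α v ≢ lookup β v × (∀ w → w ≢ v → lookup α w ≡ lookup β w)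

RConnected : Graph → ℕ → Set
RConnected G ℓ =
  ∀ (α β : Assignment G ℓ) → IsColoring G α → IsColoring G β → Star (REdge G ℓ) α β

Recolorable : Graph → Set
Recolorable G = ∀ χ → IsChromaticNumber G χ → ∀ ℓ → suc χ ≤ ℓ → RConnected G ℓ

-- A hole (induced cycle of length at least 4) in a blowup H of G projects to a hole in G:
-- consecutive vertices of a hole are separated by a third one, so they lie in different fibres,
-- and the blowup transfers adjacency and non-adjacency between different fibres.  So H has no
-- hole, hence no walk joins two non-adjacent neighbours of a vertex u while avoiding the closed
-- neighbourhood of u, since a shortest such walk closes a hole through u.  This yields Dirac's
-- lemma: every nonempty X ⊆ V(H) has a vertex simplicial in X, which can even be chosen outside
-- any given clique not containing X.  Given ℓ > χ(H) colours, delete a simplicial vertex v of X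
-- and recolour X − v by induction; every step of that recolouring lifts to X, after moving v out
-- of the way if it blocks the step.  This is possible because v and its neighbours in X form a
-- clique, so its neighbours and the blocked colour occupy at most χ(H) < ℓ colours.

module Submission where

open import Defs hiding (sym)
open import Data.Nat using (ℕ; zero; suc; _+_; _<_; _≤_; z≤n; s≤s; _≤?_)
open import Data.Nat.Properties
  using ( <-cmp; ≤-refl; ≤-trans; <-trans; ≤-pred; <⇒≤; <-irrefl; <⇒≱; n<1+n; m≤n⇒m≤1+n; m≤m+n; m<m+n
        ; +-comm; +-suc; +-monoˡ-<; m≤n⇒∃[o]m+o≡n; m≤n⇒m<n∨m≡n )
open import Data.Nat.DivMod using (_%_; m≤n⇒m%n≡m; n%n≡0)
open import Data.Nat.Induction using (<-rec)
open import Data.Nat.Tactic.RingSolver using (solve-∀)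
open import Data.Fin using (Fin; toℕ; zero; suc)
open import Data.Fin.Properties using (toℕ-injective; toℕ<n; all?; any?; _≟_; injective⇒≤)
open import Data.Fin.Subset using (Subset; outside; _∈_; _∉_; _⊆_; _⊂_; _∪_; _─_; _-_; ⁅_⁆; ⊤; Nonempty)
  renaming (⊥ to ∅)
open import Data.Fin.Subset.Properties
  using ( _∈?_; nonempty?; ∉⊥; ∈⊤; x∈⁅x⁆; x∈p∩q⁺; x∈p∪q⁺; x∈p∪q⁻; x∈p∧x∉q⇒x∈p─q; x∈p∧x≢y⇒x∈p-y
        ; p─q⊆p; p∩q≢∅⇒p─q⊂p; x∈p⇒p-x⊂p )
open import Data.Fin.Subset.Induction using (⊂-wellFounded; Acc; acc)
open import Data.Bool using (T; true)
open import Data.Bool.Properties using (T?)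
open import Data.Vec using (lookup; tabulate; _[_]≔_; _∷_; here; there)
open import Data.Vec.Properties
  using (lookup∘tabulate; tabulate∘lookup; tabulate-cong; []=⇒lookup; lookup⇒[]=; lookup∘update; lookup∘update′)
open import Data.Empty using (⊥-elim)
open import Data.Product using (∃; ∃₂; _×_; _,_; proj₁; proj₂)
open import Data.Sum using (_⊎_; inj₁; inj₂; [_,_]′; swap)
open import Function using (id; _∘_; _⇔_; mk⇔; Equivalence)
open import Relation.Nullary using (¬_; Dec; yes; no; does)
open import Relation.Nullary.Decidable using (¬?; _×-dec_; _→-dec_; decidable-stable; ¬¬-excluded-middle; dec-true)
open import Relation.Nullary.Negation using (¬¬-map)
open import Relation.Binary using (tri<; tri≈; tri>)
open import Relation.Binary.PropositionalEquality using (_≡_; _≢_; refl; sym; trans; cong; subst; ≢-sym)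
open import Relation.Binary.Construct.Closure.ReflexiveTransitive using (Star; ε; _◅_; _◅◅_; gmap)

open Equivalence using (to; from)

x∈p─q⇒x∉q : ∀ {N} (p q : Subset N) {x} → x ∈ p ─ q → x ∉ q
x∈p─q⇒x∉q (_ ∷ _) (outside ∷ _) here ()
x∈p─q⇒x∉q (_ ∷ p) (_ ∷ q) (there x∈p─q) (there x∈q) = x∈p─q⇒x∉q p q x∈p─q x∈q

¬¬-decidable : ∀ {N} (P : Fin N → Set) → ¬ ¬ (∀ x → Dec (P x))
¬¬-decidable {zero}  P k = k λ ()
¬¬-decidable {suc N} P k =
  ¬¬-excluded-middle λ P₀? → ¬¬-decidable (P ∘ suc) λ P₊? → k λ { zero → P₀? ; (suc x) → P₊? x }

module _ {N} {P : Fin N → Set} where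
  subset : (∀ x → Dec (P x)) → Subset N
  subset P? = tabulate (does ∘ P?)

  ∈-subset : (P? : ∀ x → Dec (P x)) → ∀ {x} → x ∈ subset P? ⇔ P x
  ∈-subset P? {x} = mk⇔
    (λ x∈P → does-true (P? x) (trans (sym (lookup∘tabulate _ x)) ([]=⇒lookup x∈P)))
    (λ Px → lookup⇒[]= x _ (trans (lookup∘tabulate _ x) (dec-true (P? x) Px)))
    where
    does-true : ∀ {A : Set} (a? : Dec A) → does a? ≡ true → A
    does-true (yes a) _ = a

¬¬-subset : ∀ {N} (P : Fin N → Set) → ¬ ¬ (∃ λ p → ∀ {x} → x ∈ p ⇔ P x)
¬¬-subset P = ¬¬-map (λ P? → subset P? , λ {x} → ∈-subset P? {x}) (¬¬-decidable P)

module Adjacency (Γ : Graph) where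
  Vertex : Set
  Vertex = Fin (n Γ)

  infix 4 _~_ _~?_
  _~_ : Vertex → Vertex → Set
  _~_ = Adj Γ

  _~?_ : ∀ u v → Dec (u ~ v)
  u ~? v = T? (adj Γ u v)

  ~-sym : ∀ {u v} → u ~ v → v ~ u
  ~-sym {u} {v} = subst T (Graph.sym Γ u v)

  ~-irrefl : ∀ {v} → ¬ v ~ v
  ~-irrefl {v} = subst T (irrefl Γ v)

  ~⇒≢ : ∀ {u v} → u ~ v → u ≢ v
  ~⇒≢ u~u refl = ~-irrefl u~u

module Holes (Γ : Graph) where
  open Adjacency Γ

  -- The induced cycle u, q 0, …, q M of length M + 2 ≥ 4, indexed along ℕ.
  record Hole (u : Vertex) (M : ℕ) (q : ℕ → Vertex) : Set where
    field
      long          : 2 ≤ M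
      path          : ∀ k → k < M → q k ~ q (suc k)
      apex-start    : u ~ q 0
      apex-end      : u ~ q M
      apex-nonadj   : ∀ k → 0 < k → k < M → ¬ u ~ q k
      apex-distinct : ∀ k → 0 < k → k < M → u ≢ q k
      injective     : ∀ i j → i < j → j ≤ M → q i ≢ q j
      chordless     : ∀ i j → 2 + i ≤ j → j ≤ M → ¬ q i ~ q j

  HoleFree : Set
  HoleFree = ∀ {u M q} → ¬ Hole u M q

  module _ {u M q} (hole : Hole u M q) where
    open Hole hole

    private
      L : ℕ
      L = 2 + M

      at : ℕ → Vertex
      at zero    = u
      at (suc k) = q k

      Next : ℕ → ℕ → Set
      Next a b = b ≡ (a + 1) % L

      next-suc : ∀ t → t ≤ M → Next t (suc t)
      next-suc t t≤M = sym (trans (m≤n⇒m%n≡m (subst (_≤ suc M) (+-comm 1 t) (s≤s t≤M))) (+-comm t 1))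

      next-wrap : Next (suc M) 0
      next-wrap = sym (subst (λ m → m % L ≡ 0) (cong suc (+-comm 1 M)) (n%n≡0 L))

      next⇒adj : ∀ a b → a < L → Next a b → at a ~ at b
      next⇒adj a b a<L b≡ with <-cmp a (suc M)
      next⇒adj zero    _ _ refl | tri< _ _ _ = subst (λ m → u ~ at m) (next-suc 0 z≤n) apex-start
      next⇒adj (suc k) _ _ refl | tri< a<M _ _ =
        subst (λ m → q k ~ at m) (next-suc (suc k) (≤-pred a<M)) (path k (≤-pred a<M))
      next⇒adj a _ _ refl | tri≈ _ refl _ = subst (λ m → q M ~ at m) next-wrap (~-sym apex-end)
      next⇒adj a _ a<L _ | tri> _ _ a>M = ⊥-elim (<-irrefl refl (≤-trans a<L a>M))

      apex-adj⇒next : ∀ k → k ≤ M → u ~ q k → Next 0 (suc k) ⊎ Next (suc k) 0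
      apex-adj⇒next zero _ _ = inj₁ (next-suc 0 z≤n)
      apex-adj⇒next (suc k) k≤M u~q with <-cmp (suc k) M
      ... | tri< k<M _ _ = ⊥-elim (apex-nonadj (suc k) (s≤s z≤n) k<M u~q)
      ... | tri≈ _ refl _ = inj₂ next-wrap
      ... | tri> _ _ k>M = ⊥-elim (<-irrefl refl (≤-trans k>M k≤M))

      close⇒next : ∀ i j → i < j → j ≤ M → q i ~ q j → Next (suc i) (suc j)
      close⇒next i j i<j j≤M qi~qj with <-cmp j (suc i)
      ... | tri< j<i+1 _ _ = ⊥-elim (<-irrefl refl (≤-trans (s≤s i<j) j<i+1))
      ... | tri≈ _ refl _ = next-suc (suc i) j≤M
      ... | tri> _ _ i+1<j = ⊥-elim (chordless i j i+1<j j≤M qi~qj)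

      adj⇒next : ∀ a b → a < L → b < L → at a ~ at b → Next a b ⊎ Next b a
      adj⇒next zero    zero    _   _   u~u = ⊥-elim (~-irrefl u~u)
      adj⇒next zero    (suc j) _   b<L u~q = apex-adj⇒next j (≤-pred (≤-pred b<L)) u~q
      adj⇒next (suc i) zero    a<L _   q~u = swap (apex-adj⇒next i (≤-pred (≤-pred a<L)) (~-sym q~u))
      adj⇒next (suc i) (suc j) a<L b<L q~q with <-cmp i j
      ... | tri< i<j _ _ = inj₁ (close⇒next i j i<j (≤-pred (≤-pred b<L)) q~q)
      ... | tri≈ _ refl _ = ⊥-elim (~-irrefl q~q)
      ... | tri> _ _ j<i = inj₂ (close⇒next j i j<i (≤-pred (≤-pred a<L)) (~-sym q~q))

      apex≢ : ∀ k → k ≤ M → u ≢ q k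
      apex≢ zero _ u≡q = ~-irrefl (subst (u ~_) (sym u≡q) apex-start)
      apex≢ (suc k) k≤M u≡q with <-cmp (suc k) M
      ... | tri< k<M _ _ = apex-distinct (suc k) (s≤s z≤n) k<M u≡q
      ... | tri≈ _ refl _ = ~-irrefl (subst (u ~_) (sym u≡q) apex-end)
      ... | tri> _ _ k>M = <-irrefl refl (≤-trans k>M k≤M)

      at-injective : ∀ a b → a < L → b < L → at a ≡ at b → a ≡ b
      at-injective zero    zero    _   _   _ = refl
      at-injective zero    (suc j) _   b<L e = ⊥-elim (apex≢ j (≤-pred (≤-pred b<L)) e)
      at-injective (suc i) zero    a<L _   e = ⊥-elim (apex≢ i (≤-pred (≤-pred a<L)) (sym e))
      at-injective (suc i) (suc j) a<L b<L e with <-cmp i j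
      ... | tri< i<j _ _ = ⊥-elim (injective i j i<j (≤-pred (≤-pred b<L)) e)
      ... | tri≈ _ i≡j _ = cong suc i≡j
      ... | tri> _ _ j<i = ⊥-elim (injective j i j<i (≤-pred (≤-pred a<L)) (sym e))

    hole⇒inducedCycle : InducedCycle Γ (2 + M)
    hole⇒inducedCycle =
      at ∘ toℕ , (λ e → toℕ-injective (at-injective _ _ (toℕ<n _) (toℕ<n _) e)) ,
      λ i j → adj⇒next (toℕ i) (toℕ j) (toℕ<n i) (toℕ<n j) ,
              λ { (inj₁ next) → next⇒adj (toℕ i) (toℕ j) (toℕ<n i) next
                ; (inj₂ next) → ~-sym (next⇒adj (toℕ j) (toℕ i) (toℕ<n j) next) }

  chordal⇒holeFree : Chordal Γ → HoleFree
  chordal⇒holeFree chordal hole = chordal _ (s≤s (s≤s (Hole.long hole))) (hole⇒inducedCycle hole)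

module Blowup {G H : Graph} (blowup : IsBlowupOf H G) where
  open Adjacency H
  module G = Adjacency G
  open Holes H

  π : Vertex → G.Vertex
  π = proj₁ blowup

  private
    fibres : ∀ u v → u ≢ v → (u ~ v → π u ≡ π v ⊎ π u G.~ π v) × (π u ≡ π v ⊎ π u G.~ π v → u ~ v)
    fibres = proj₂ (proj₂ blowup)

  projects : ∀ {x y} → x ~ y → π x ≢ π y → π x G.~ π y
  projects {x} {y} x~y πx≢πy with proj₁ (fibres x y (~⇒≢ x~y)) x~y
  ... | inj₁ πx≡πy = ⊥-elim (πx≢πy πx≡πy)
  ... | inj₂ πx~πy = πx~πy

  lifts : ∀ {x y} → π x G.~ π y → x ~ y
  lifts {x} {y} πx~πy = proj₂ (fibres x y x≢y) (inj₂ πx~πy)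
    where
    x≢y : x ≢ y
    x≢y refl = G.~-irrefl πx~πy

  same-fibre⇒adj : ∀ {x y} → x ≢ y → π x ≡ π y → x ~ y
  same-fibre⇒adj {x} {y} x≢y πx≡πy = proj₂ (fibres x y x≢y) (inj₁ πx≡πy)

  -- Vertices in a common fibre have the same neighbours outside it.
  separated⇒different-fibres : ∀ {z x y} → z ~ x → ¬ z ~ y → z ≢ y → π x ≢ π y
  separated⇒different-fibres {z} {x} {y} z~x z≁y z≢y πx≡πy with proj₁ (fibres z x (~⇒≢ z~x)) z~x
  ... | inj₁ πz≡πx = z≁y (same-fibre⇒adj z≢y (trans πz≡πx πx≡πy))
  ... | inj₂ πz~πx = z≁y (lifts (subst (π z G.~_) πx≡πy πz~πx))

  project-hole : ∀ {u M q} → Hole u M q → Holes.Hole G (π u) M (π ∘ q)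
  project-hole {u} {M} {q} hole = record
    { long          = long
    ; path          = λ k k<M → projects (path k k<M) (path-fibres k k<M)
    ; apex-start    = projects apex-start (apex-fibre 1 (s≤s z≤n) long (~-sym (path 0 (<-trans (s≤s z≤n) long))))
    ; apex-end      = projects apex-end apex-end-fibre
    ; apex-nonadj   = λ k 0<k k<M πu~πq → apex-nonadj k 0<k k<M (lifts πu~πq)
    ; apex-distinct = λ k 0<k k<M πu≡πq → apex-nonadj k 0<k k<M (same-fibre⇒adj (apex-distinct k 0<k k<M) πu≡πq)
    ; injective     = injective-fibres
    ; chordless     = λ i j i+2≤j j≤M πqi~πqj → chordless i j i+2≤j j≤M (lifts πqi~πqj)
    }
    where
    open Hole hole
    apex-fibre : ∀ k {j} → 0 < k → k < M → q k ~ q j → π u ≢ π (q j)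
    apex-fibre k 0<k k<M qk~qj πu≡πqj =
      separated⇒different-fibres qk~qj (λ qk~u → apex-nonadj k 0<k k<M (~-sym qk~u))
        (λ qk≡u → apex-distinct k 0<k k<M (sym qk≡u)) (sym πu≡πqj)

    apex-end-fibre : π u ≢ π (q M)
    apex-end-fibre with m≤n⇒∃[o]m+o≡n long
    ... | o , refl = apex-fibre (suc o) (s≤s z≤n) ≤-refl (path (suc o) ≤-refl)

    path-fibres : ∀ k → k < M → π (q k) ≢ π (q (suc k))
    path-fibres zero    k<M =
      separated⇒different-fibres apex-start (apex-nonadj 1 (s≤s z≤n) long) (apex-distinct 1 (s≤s z≤n) long)
    path-fibres (suc k) k<M =
      separated⇒different-fibres (path k (<-trans (n<1+n k) k<M)) (chordless k (2 + k) ≤-refl k<M)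
        (injective k (2 + k) (m≤n⇒m≤1+n (n<1+n k)) k<M)

    injective-fibres : ∀ i j → i < j → j ≤ M → π (q i) ≢ π (q j)
    injective-fibres i j i<j j≤M with m≤n⇒m<n∨m≡n i<j
    ... | inj₁ i+1<j = chordless i j i+1<j j≤M ∘ same-fibre⇒adj (injective i j i<j j≤M)
    ... | inj₂ refl  = path-fibres i j≤M

module Bypasses (Γ : Graph) where
  open Adjacency Γ
  open Holes Γ

  record Bypass (u : Vertex) (M : ℕ) (q : ℕ → Vertex) : Set where
    field
      path          : ∀ k → k < M → q k ~ q (suc k)
      ends-distinct : q 0 ≢ q M
      ends-nonadj   : ¬ q 0 ~ q M
      apex-start    : u ~ q 0
      apex-end      : u ~ q M
      apex-nonadj   : ∀ k → 0 < k → k < M → ¬ u ~ q k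
      apex-distinct : ∀ k → 0 < k → k < M → u ≢ q k

  skip : ℕ → ℕ → ℕ → ℕ
  skip i d k with k ≤? i
  ... | yes _ = k
  ... | no _  = k + d

  skip-≤ : ∀ {i d k} → k ≤ i → skip i d k ≡ k
  skip-≤ {i} {d} {k} k≤i with k ≤? i
  ... | yes _  = refl
  ... | no k≰i = ⊥-elim (k≰i k≤i)

  skip-> : ∀ {i d k} → i < k → skip i d k ≡ k + d
  skip-> {i} {d} {k} i<k with k ≤? i
  ... | yes k≤i = ⊥-elim (<-irrefl refl (≤-trans i<k k≤i))
  ... | no _    = refl

  module _ {u M q} (bypass : Bypass u M q) where
    open Bypass bypass

    private
      ~-cong : ∀ {a a′ b b′} → a ≡ a′ → b ≡ b′ → a ~ b → a′ ~ b′
      ~-cong refl refl a~b = a~b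

    -- Cut out the d vertices strictly between q i and q (suc i + d).
    shortcut : ∀ i d M′ → i < M′ → M′ + d ≡ M → q i ~ q (suc i + d) → Bypass u M′ (λ k → q (skip i d k))
    shortcut i d M′ i<M′ M′+d≡M chord = record
      { path          = path′
      ; ends-distinct = λ e → ends-distinct (trans (sym start) (trans e end))
      ; ends-nonadj   = λ a → ends-nonadj (~-cong start end a)
      ; apex-start    = subst (u ~_) (sym start) apex-start
      ; apex-end      = subst (u ~_) (sym end) apex-end
      ; apex-nonadj   = λ k 0<k k<M′ → apex-nonadj (skip i d k) (skip-pos k 0<k) (skip-bound k k<M′)
      ; apex-distinct = λ k 0<k k<M′ → apex-distinct (skip i d k) (skip-pos k 0<k) (skip-bound k k<M′)
      }
      where
      M′≤M : M′ ≤ M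
      M′≤M = subst (M′ ≤_) M′+d≡M (m≤m+n M′ d)

      shifted-bound : ∀ k → k < M′ → k + d < M
      shifted-bound k k<M′ = subst (k + d <_) M′+d≡M (+-monoˡ-< d k<M′)

      start : q (skip i d 0) ≡ q 0
      start = cong q (skip-≤ {i} {d} z≤n)

      end : q (skip i d M′) ≡ q M
      end = cong q (trans (skip-> i<M′) M′+d≡M)

      path′ : ∀ k → k < M′ → q (skip i d k) ~ q (skip i d (suc k))
      path′ k k<M′ with <-cmp k i
      ... | tri< k<i _ _ =
        ~-cong (cong q (sym (skip-≤ (<⇒≤ k<i)))) (cong q (sym (skip-≤ k<i))) (path k (≤-trans k<M′ M′≤M))
      ... | tri≈ _ refl _ =
        ~-cong (cong q (sym (skip-≤ ≤-refl))) (cong q (sym (skip-> (n<1+n i)))) chord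
      ... | tri> _ _ i<k =
        ~-cong (cong q (sym (skip-> i<k))) (cong q (sym (skip-> (<-trans i<k (n<1+n k)))))
          (path (k + d) (shifted-bound k k<M′))

      skip-pos : ∀ k → 0 < k → 0 < skip i d k
      skip-pos k 0<k with k ≤? i
      ... | yes _ = 0<k
      ... | no _  = ≤-trans 0<k (m≤m+n k d)

      skip-bound : ∀ k → k < M′ → skip i d k < M
      skip-bound k k<M′ with k ≤? i
      ... | yes _ = ≤-trans k<M′ M′≤M
      ... | no _  = shifted-bound k k<M′

    ShorterBypass : Set
    ShorterBypass = ∃₂ λ M′ q′ → M′ < M × Bypass u M′ q′

    chord⇒shorter : ∀ i j → suc i < j → j ≤ M → q i ~ q j → ShorterBypass
    chord⇒shorter i j i+1<j j≤M qi~qj with m≤n⇒∃[o]m+o≡n i+1<j | m≤n⇒∃[o]m+o≡n j≤M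
    ... | e , refl | f , refl =
      suc i + f , _ , subst (suc i + f <_) lengths (m<m+n (suc i + f) (s≤s z≤n)) ,
      shortcut i (suc e) (suc i + f) (s≤s (m≤m+n i f)) lengths
        (subst (λ m → q i ~ q m) (cong suc (sym (+-suc i e))) qi~qj)
      where
      rearrange : ∀ i e f → suc i + f + suc e ≡ suc (suc i + e) + f
      rearrange = solve-∀
      lengths = rearrange i e f

    minimal⇒hole : ¬ ShorterBypass → 2 ≤ M → Hole u M q
    minimal⇒hole minimal long = record
      { long = long ; path = path ; apex-start = apex-start ; apex-end = apex-end
      ; apex-nonadj = apex-nonadj ; apex-distinct = apex-distinct
      ; injective = injective ; chordless = chordless }
      where
      chordless : ∀ i j → 2 + i ≤ j → j ≤ M → ¬ q i ~ q j
      chordless i j i+1<j j≤M qi~qj = minimal (chord⇒shorter i j i+1<j j≤M qi~qj)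

      injective : ∀ i j → i < j → j ≤ M → q i ≢ q j
      injective i j i<j j≤M qi≡qj with m≤n⇒m<n∨m≡n j≤M
      ... | inj₁ j<M = chordless i (suc j) (s≤s i<j) j<M (subst (_~ q (suc j)) (sym qi≡qj) (path j j<M))
      injective zero    _ _   _ q0≡qM | inj₂ refl = ends-distinct q0≡qM
      injective (suc i) _ i<M _ qi≡qM | inj₂ refl =
        chordless i M i<M ≤-refl (subst (q i ~_) qi≡qM (path i (<-trans (n<1+n i) i<M)))

  bypass-long : ∀ {u M q} → Bypass u M q → 2 ≤ M
  bypass-long {M = zero}        bypass = ⊥-elim (Bypass.ends-distinct bypass refl)
  bypass-long {M = suc zero}    bypass = ⊥-elim (Bypass.ends-nonadj bypass (Bypass.path bypass 0 (s≤s z≤n)))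
  bypass-long {M = suc (suc _)} _      = s≤s (s≤s z≤n)

  holeFree⇒bypassFree : HoleFree → ∀ {u M q} → ¬ Bypass u M q
  holeFree⇒bypassFree holeFree {u} {M} = <-rec (λ M → ∀ {q} → ¬ Bypass u M q) shortest M
    where
    shortest : ∀ M → (∀ {M′} → M′ < M → ∀ {q} → ¬ Bypass u M′ q) → ∀ {q} → ¬ Bypass u M q
    shortest M shorter bypass =
      holeFree (minimal⇒hole bypass (λ (_ , _ , M′<M , bypass′) → shorter M′<M bypass′) (bypass-long bypass))

module SimplicialVertices (Γ : Graph) where
  open Adjacency Γ
  open Bypasses Γ

  VSet : Set
  VSet = Subset (n Γ)

  Clique : VSet → Set
  Clique K = ∀ {a b} → a ∈ K → b ∈ K → a ≢ b → a ~ b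

  Simplicial : VSet → Vertex → Set
  Simplicial X s = ∀ a b → a ∈ X → b ∈ X → s ~ a → s ~ b → a ≢ b → a ~ b

  simplicial? : ∀ X s → Dec (Simplicial X s)
  simplicial? X s = all? λ a → all? λ b →
    a ∈? X →-dec b ∈? X →-dec s ~? a →-dec s ~? b →-dec ¬? (a ≟ b) →-dec a ~? b

  SimplicialOutside : VSet → VSet → Set
  SimplicialOutside X K = ∃ λ s → s ∈ X × s ∉ K × Simplicial X s

  simplicialOutside? : ∀ X K → Dec (SimplicialOutside X K)
  simplicialOutside? X K = any? λ s → s ∈? X ×-dec ¬? (s ∈? K) ×-dec simplicial? X s

  Link : (Vertex → Set) → Vertex → Vertex → Set
  Link W a b = W a × W b × a ~ b

  Reachable : (Vertex → Set) → Vertex → Vertex → Set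
  Reachable W = Star (Link W)

  reverse : ∀ {W x y} → Reachable W x y → Reachable W y x
  reverse ε                       = ε
  reverse ((wa , wb , a~b) ◅ walk) = reverse walk ◅◅ ((wb , wa , ~-sym a~b) ◅ ε)

  reachable-inside : ∀ {W x y} → W x → Reachable W x y → W y
  reachable-inside wx ε                    = wx
  reachable-inside _  ((_ , wb , _) ◅ walk) = reachable-inside wb walk

  -- The walk is continued by next at index suc len, so that a last step can be appended without a case split.
  record IndexedWalk (W : Vertex → Set) (x y next : Vertex) : Set where
    field
      len    : ℕ
      at     : ℕ → Vertex
      start  : at 0 ≡ x
      end    : at len ≡ y
      after  : at (suc len) ≡ next
      inside : ∀ k → k ≤ len → W (at k)
      step   : ∀ k → k < len → at k ~ at (suc k)

  index : ∀ {W x y} → W x → Reachable W x y → ∀ next → IndexedWalk W x y next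
  index {x = x} wx ε next = record
    { len = 0 ; at = λ { zero → x ; (suc _) → next }
    ; start = refl ; end = refl ; after = refl
    ; inside = λ { zero _ → wx } ; step = λ _ () }
  index {x = x} wx ((_ , wb , x~b) ◅ walk) next = record
    { len = suc len ; at = at′ ; start = refl ; end = end ; after = after
    ; inside = λ { zero _ → wx ; (suc k) k<len → inside k (≤-pred k<len) }
    ; step = λ { zero _ → subst (x ~_) (sym start) x~b ; (suc k) k<len → step k (≤-pred k<len) } }
    where
    open IndexedWalk (index wb walk next)
    at′ : ℕ → Vertex
    at′ zero    = x
    at′ (suc k) = at k

  walk⇒bypass : ∀ {W u s₁ s₂ c₁ c₂} → (∀ {z} → W z → ¬ u ~ z × u ≢ z) → W c₁ → Reachable W c₁ c₂ →
                s₁ ~ c₁ → c₂ ~ s₂ → s₁ ≢ s₂ → ¬ s₁ ~ s₂ → u ~ s₁ → u ~ s₂ → ∃₂ λ M q → Bypass u M q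
  walk⇒bypass {u = u} {s₁} {s₂} {c₂ = c₂} far wc₁ walk s₁~c₁ c₂~s₂ s₁≢s₂ s₁≁s₂ u~s₁ u~s₂ = 2 + len , q , record
    { path          = path
    ; ends-distinct = λ e → s₁≢s₂ (trans e after)
    ; ends-nonadj   = λ s₁~ → s₁≁s₂ (subst (s₁ ~_) after s₁~)
    ; apex-start    = u~s₁
    ; apex-end      = subst (u ~_) (sym after) u~s₂
    ; apex-nonadj   = λ { (suc k) _ (s≤s k<) → proj₁ (far (inside k (≤-pred k<))) }
    ; apex-distinct = λ { (suc k) _ (s≤s k<) → proj₂ (far (inside k (≤-pred k<))) } }
    where
    open IndexedWalk (index wc₁ walk s₂)
    q : ℕ → Vertex
    q zero    = s₁
    q (suc k) = at k
    path : ∀ k → k < 2 + len → q k ~ q (suc k)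
    path zero _ = subst (s₁ ~_) (sym start) s₁~c₁
    path (suc k) (s≤s k<) with <-cmp k len
    ... | tri< k<len _ _ = step k k<len
    ... | tri≈ _ refl _ = subst (_~ at (suc k)) (sym end) (subst (c₂ ~_) (sym after) c₂~s₂)
    ... | tri> _ _ k>len = ⊥-elim (<-irrefl refl (≤-trans (s≤s k>len) k<))

  record Separation (X : VSet) : Set where
    field
      u b        : Vertex
      C S        : VSet
      u∈X        : u ∈ X
      b∈C        : b ∈ C
      C⊆X        : C ⊆ X
      S⊆X        : S ⊆ X
      u∉C        : u ∉ C
      u∉S        : u ∉ S
      S∉C        : ∀ {z} → z ∈ S → z ∉ C
      boundary   : ∀ {z c} → z ∈ X → z ∉ C → c ∈ C → z ~ c → z ∈ S
      S-clique   : Clique S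

  module _ (bypassFree : ∀ {u M q} → ¬ Bypass u M q) where

    module Separate {X u b} (u∈X : u ∈ X) (b∈X : b ∈ X) (u≢b : u ≢ b) (u≁b : ¬ u ~ b) where
      Far : Vertex → Set
      Far z = z ∈ X × u ≢ z × ¬ u ~ z

      far-b : Far b
      far-b = b∈X , u≢b , u≁b

      Boundary : VSet → Vertex → Set
      Boundary C z = z ∈ X × z ∉ C × ∃ λ c → c ∈ C × z ~ c

      module _ (C : VSet) (C⇔ : ∀ {z} → z ∈ C ⇔ Reachable Far b z) where
        C-far : ∀ {c} → c ∈ C → Far c
        C-far c∈C = reachable-inside far-b (to C⇔ c∈C)

        C-closed : ∀ {c z} → c ∈ C → Far z → c ~ z → z ∈ C
        C-closed c∈C far-z c~z = from C⇔ (to C⇔ c∈C ◅◅ ((C-far c∈C , far-z , c~z) ◅ ε))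

        module _ (S : VSet) (S⇔ : ∀ {z} → z ∈ S ⇔ Boundary C z) where
          S-near : ∀ {z} → z ∈ S → u ~ z
          S-near {z} z∈S with to S⇔ z∈S
          ... | z∈X , z∉C , c , c∈C , z~c =
            decidable-stable (u ~? z) λ u≁z → z∉C (C-closed c∈C (z∈X , u≢z , u≁z) (~-sym z~c))
            where
            u≢z : u ≢ z
            u≢z refl = proj₂ (proj₂ (C-far c∈C)) z~c

          -- Two non-adjacent vertices of S would be joined through C by a bypass of u.
          S-clique : Clique S
          S-clique {s₁} {s₂} s₁∈S s₂∈S s₁≢s₂ with to S⇔ s₁∈S | to S⇔ s₂∈S
          ... | _ , _ , c₁ , c₁∈C , s₁~c₁ | _ , _ , c₂ , c₂∈C , s₂~c₂ =
            decidable-stable (s₁ ~? s₂) λ s₁≁s₂ →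
              bypassFree (proj₂ (proj₂ (walk⇒bypass (λ (_ , u≢z , u≁z) → u≁z , u≢z) (C-far c₁∈C)
                (reverse (to C⇔ c₁∈C) ◅◅ to C⇔ c₂∈C) s₁~c₁ (~-sym s₂~c₂) s₁≢s₂ s₁≁s₂ (S-near s₁∈S) (S-near s₂∈S))))

          separation : Separation X
          separation = record
            { u = u ; b = b ; C = C ; S = S ; u∈X = u∈X
            ; b∈C      = from C⇔ ε
            ; C⊆X      = proj₁ ∘ C-far
            ; S⊆X      = proj₁ ∘ to S⇔
            ; u∉C      = λ u∈C → proj₁ (proj₂ (C-far u∈C)) refl
            ; u∉S      = λ u∈S → ~-irrefl (S-near u∈S)
            ; S∉C      = proj₁ ∘ proj₂ ∘ to S⇔
            ; boundary = λ z∈X z∉C c∈C z~c → from S⇔ (z∈X , z∉C , _ , c∈C , z~c)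
            ; S-clique = S-clique }

      ¬¬-separation : ¬ ¬ Separation X
      ¬¬-separation k = ¬¬-subset (Reachable Far b) λ (C , C⇔) →
        ¬¬-subset (Boundary C) λ (S , S⇔) → k (separation C (λ {z} → C⇔ {z}) S (λ {z} → S⇔ {z}))

    ¬clique⇒¬¬separation : ∀ {X} → ¬ Clique X → ¬ ¬ Separation X
    ¬clique⇒¬¬separation ¬clique k = ¬clique λ {a} {b} a∈X b∈X a≢b →
      decidable-stable (a ~? b) λ a≁b → Separate.¬¬-separation a∈X b∈X a≢b a≁b k

    private
      Rec : VSet → Set
      Rec X = ∀ {Y} → Y ⊂ X → ∀ {K} → Clique K → (∃ λ y → y ∈ Y × y ∉ K) → SimplicialOutside Y K

    module _ {X K} (rec : Rec X) (K-clique : Clique K) (sep : Separation X) where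
      open Separation sep

      X─C⊂X : X ─ C ⊂ X
      X─C⊂X = p∩q≢∅⇒p─q⊂p X C (b , x∈p∩q⁺ (C⊆X b∈C , b∈C))

      C∪S⊂X : C ∪ S ⊂ X
      C∪S⊂X = (λ z∈C∪S → [ C⊆X , S⊆X ]′ (x∈p∪q⁻ C S z∈C∪S)) ,
              u , u∈X , λ u∈C∪S → [ u∉C , u∉S ]′ (x∈p∪q⁻ C S u∈C∪S)

      -- Recurse on X minus C: a simplicial vertex there outside S has no neighbour in C.
      K-meets-C : ∀ {k} → k ∈ K → k ∈ C → SimplicialOutside X K
      K-meets-C {k} k∈K k∈C with rec X─C⊂X S-clique (u , x∈p∧x∉q⇒x∈p─q u∈X u∉C , u∉S)
      ... | s , s∈Y , s∉S , simplicial =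
            s , s∈X , s∉K , λ a b a∈X b∈X s~a s~b → simplicial a b (near a∈X s~a) (near b∈X s~b) s~a s~b
        where
        s∈X : s ∈ X
        s∈X = p─q⊆p X C s∈Y
        s∉C : s ∉ C
        s∉C = x∈p─q⇒x∉q X C s∈Y
        s≁C : ∀ {c} → c ∈ C → ¬ s ~ c
        s≁C c∈C s~c = s∉S (boundary s∈X s∉C c∈C s~c)
        s∉K : s ∉ K
        s∉K s∈K = s≁C k∈C (K-clique s∈K k∈K λ { refl → s∉C k∈C })
        near : ∀ {a} → a ∈ X → s ~ a → a ∈ X ─ C
        near a∈X s~a = x∈p∧x∉q⇒x∈p─q a∈X (λ a∈C → s≁C a∈C s~a)

      -- Recurse on C ∪ S: a simplicial vertex there outside S lies in C, so all its neighbours in X are in C ∪ S.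
      K-misses-C : ¬ (∃ λ k → k ∈ K × k ∈ C) → SimplicialOutside X K
      K-misses-C misses with rec C∪S⊂X S-clique (b , x∈p∪q⁺ (inj₁ b∈C) , λ b∈S → S∉C b∈S b∈C)
      ... | s , s∈Y , s∉S , simplicial =
            s , C⊆X s∈C , (λ s∈K → misses (s , s∈K , s∈C)) ,
            λ a b a∈X b∈X s~a s~b → simplicial a b (near a∈X s~a) (near b∈X s~b) s~a s~b
        where
        s∈C : s ∈ C
        s∈C = [ (λ s∈C → s∈C) , (λ s∈S → ⊥-elim (s∉S s∈S)) ]′ (x∈p∪q⁻ C S s∈Y)
        near : ∀ {a} → a ∈ X → s ~ a → a ∈ C ∪ S
        near {a} a∈X s~a with a ∈? C
        ... | yes a∈C = x∈p∪q⁺ (inj₁ a∈C)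
        ... | no a∉C  = x∈p∪q⁺ (inj₂ (boundary a∈X a∉C s∈C (~-sym s~a)))

    -- The goal is decidable, so the case analyses may be classical.
    simplicial-outside : ∀ X → Acc _⊂_ X → ∀ {K} → Clique K → (∃ λ x → x ∈ X × x ∉ K) → SimplicialOutside X K
    simplicial-outside X (acc smaller) {K} K-clique (x , x∈X , x∉K) =
      decidable-stable (simplicialOutside? X K) λ none → ¬¬-excluded-middle (by-clique none)
      where
      rec : Rec X
      rec Y⊂X = simplicial-outside _ (smaller Y⊂X)

      by-separation : ¬ SimplicialOutside X K → (sep : Separation X) → ¬ Dec (∃ λ k → k ∈ K × k ∈ Separation.C sep)
      by-separation none sep (yes (k , k∈K , k∈C)) = none (K-meets-C rec K-clique sep k∈K k∈C)
      by-separation none sep (no misses)           = none (K-misses-C rec K-clique sep misses)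

      by-clique : ¬ SimplicialOutside X K → ¬ Dec (Clique X)
      by-clique none (yes X-clique) = none (x , x∈X , x∉K , λ a b a∈X b∈X _ _ → X-clique a∈X b∈X)
      by-clique none (no ¬clique)   =
        ¬clique⇒¬¬separation ¬clique λ sep → ¬¬-excluded-middle (by-separation none sep)

    simplicial-vertex : ∀ X → Nonempty X → ∃ λ s → s ∈ X × Simplicial X s
    simplicial-vertex X (x , x∈X) = forget (simplicial-outside X (⊂-wellFounded X) {∅} ∅-clique (x , x∈X , ∉⊥))
      where
      ∅-clique : Clique ∅
      ∅-clique a∈∅ = ⊥-elim (∉⊥ a∈∅)
      forget : SimplicialOutside X ∅ → ∃ λ s → s ∈ X × Simplicial X s
      forget (s , s∈X , _ , simplicial) = s , s∈X , simplicial

module Recolouring (Γ : Graph) {ℓ : ℕ} where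
  open Adjacency Γ
  open SimplicialVertices Γ

  Colouring : Set
  Colouring = Assignment Γ ℓ

  record ProperOn (X : VSet) (α : Colouring) : Set where
    constructor proper-on
    field apart : ∀ {a b} → a ∈ X → b ∈ X → a ~ b → lookup α a ≢ lookup α b
  open ProperOn

  AgreeOn : VSet → Colouring → Colouring → Set
  AgreeOn X α β = ∀ {z} → z ∈ X → lookup α z ≡ lookup β z

  record Step (X : VSet) (α β : Colouring) : Set where
    field
      source-proper : ProperOn X α
      target-proper : ProperOn X β
      recoloured    : Vertex
      recoloured∈X  : recoloured ∈ X
      changed       : lookup α recoloured ≢ lookup β recoloured
      unchanged     : ∀ z → z ≢ recoloured → lookup α z ≡ lookup β z

  Recolourable : VSet → Set
  Recolourable X = ∀ {α β} → ProperOn X α → ProperOn X β → ∃ λ γ → Star (Step X) α γ × AgreeOn X γ β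

  update-proper : ∀ {X α w c} → ProperOn X α → (∀ {z} → z ∈ X → w ~ z → lookup α z ≢ c) →
                  ProperOn X (α [ w ]≔ c)
  update-proper {X} {α} {w} {c} proper fresh = proper-on apart′
    where
    apart′ : ∀ {a b} → a ∈ X → b ∈ X → a ~ b → lookup (α [ w ]≔ c) a ≢ lookup (α [ w ]≔ c) b
    apart′ {a} {b} a∈X b∈X a~b with a ≟ w | b ≟ w
    ... | yes refl | yes refl = ⊥-elim (~-irrefl a~b)
    ... | yes refl | no b≢w  = λ e →
      fresh b∈X a~b (sym (trans (sym (lookup∘update a α c)) (trans e (lookup∘update′ b≢w α c))))
    ... | no a≢w  | yes refl = λ e →
      fresh a∈X (~-sym a~b) (trans (sym (lookup∘update′ a≢w α c)) (trans e (lookup∘update b α c)))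
    ... | no a≢w  | no b≢w  = λ e →
      apart proper a∈X b∈X a~b (trans (sym (lookup∘update′ a≢w α c)) (trans e (lookup∘update′ b≢w α c)))

  update-step : ∀ {X α w c} → ProperOn X α → ProperOn X (α [ w ]≔ c) → w ∈ X → lookup α w ≢ c →
                Step X α (α [ w ]≔ c)
  update-step {α = α} {w} {c} proper proper′ w∈X αw≢c = record
    { source-proper = proper ; target-proper = proper′ ; recoloured = w ; recoloured∈X = w∈X
    ; changed = λ e → αw≢c (trans e (lookup∘update w α c))
    ; unchanged = λ z z≢w → sym (lookup∘update′ z≢w α c) }

  module DeleteSimplicial {χ} (κ : Assignment Γ χ) (κ-proper : IsColoring Γ κ) (χ<ℓ : χ < ℓ)
                {X v} (v∈X : v ∈ X) (simplicial : Simplicial X v) where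

    private
      ∈X-v⁻ : ∀ {z} → z ∈ X - v → z ∈ X × z ≢ v
      ∈X-v⁻ {z} z∈X-v = p─q⊆p X ⁅ v ⁆ z∈X-v , λ { refl → x∈p─q⇒x∉q X ⁅ v ⁆ z∈X-v (x∈⁅x⁆ v) }

    restrict : ∀ {α} → ProperOn X α → ProperOn (X - v) α
    restrict proper = proper-on λ a∈ b∈ → apart proper (proj₁ (∈X-v⁻ a∈)) (proj₁ (∈X-v⁻ b∈))

    Taken : Colouring → Fin ℓ → Fin ℓ → Set
    Taken β c d = d ≡ c ⊎ ∃ λ z → z ∈ X × v ~ z × lookup β z ≡ d

    -- The neighbours of v in X form a clique with v, so together with c they use at most χ < ℓ colours.
    free-colour : ∀ β c → ∃ λ d → d ≢ c × (∀ z → z ∈ X → v ~ z → lookup β z ≢ d)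
    free-colour β c = decidable-stable
      (any? λ d → ¬? (d ≟ c) ×-dec all? λ z → z ∈? X →-dec v ~? z →-dec ¬? (lookup β z ≟ d))
      λ none → <⇒≱ χ<ℓ (injective⇒≤ (λ {d} {d′} → owner-injective (taken none d) (taken none d′)))
      where
      taken : ¬ (∃ λ d → d ≢ c × (∀ z → z ∈ X → v ~ z → lookup β z ≢ d)) → ∀ d → Taken β c d
      taken none d with d ≟ c
      ... | yes d≡c = inj₁ d≡c
      ... | no d≢c  = inj₂ (decidable-stable (any? λ z → z ∈? X ×-dec v ~? z ×-dec lookup β z ≟ d)
                       λ unused → none (d , d≢c , λ z z∈X v~z βz≡d → unused (z , z∈X , v~z , βz≡d)))

      owner : ∀ {d} → Taken β c d → Vertex
      owner = [ (λ _ → v) , proj₁ ]′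

      owner-injective : ∀ {d d′} (t : Taken β c d) (t′ : Taken β c d′) →
                        lookup κ (owner t) ≡ lookup κ (owner t′) → d ≡ d′
      owner-injective (inj₁ refl) (inj₁ refl) _ = refl
      owner-injective (inj₁ _) (inj₂ (z , _ , v~z , _)) κ≡ = ⊥-elim (κ-proper _ _ v~z κ≡)
      owner-injective (inj₂ (z , _ , v~z , _)) (inj₁ _) κ≡ = ⊥-elim (κ-proper _ _ v~z (sym κ≡))
      owner-injective (inj₂ (z , z∈X , v~z , refl)) (inj₂ (z′ , z′∈X , v~z′ , refl)) κ≡
        with z ≟ z′
      ... | yes refl = refl
      ... | no z≢z′  = ⊥-elim (κ-proper _ _ (simplicial z z′ z∈X z′∈X v~z v~z′ z≢z′) κ≡)

    record Shadow (β α : Colouring) : Set where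
      constructor shadow
      field
        proper : ProperOn X β
        agrees : ∀ z → z ≢ v → lookup β z ≡ lookup α z

    Lift : Colouring → Colouring → Set
    Lift β α = ∃ λ β′ → Star (Step X) β β′ × Shadow β′ α

    prepend : ∀ {β β₁ α} → Star (Step X) β β₁ → Lift β₁ α → Lift β α
    prepend steps (β′ , steps′ , shade) = β′ , steps ◅◅ steps′ , shade

    module LiftStep {α α₁} (step : Step (X - v) α α₁) where
      open Step step renaming (target-proper to α₁-proper; recoloured to w; recoloured∈X to w∈X-v)

      c : Fin ℓ
      c = lookup α₁ w

      w∈X : w ∈ X
      w∈X = proj₁ (∈X-v⁻ w∈X-v)

      w≢v : w ≢ v
      w≢v = proj₂ (∈X-v⁻ w∈X-v)

      recolour-w : ∀ {β} → Shadow β α → lookup β v ≢ c → Lift β α₁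
      recolour-w {β} (shadow β-proper β≈α) βv≢c =
        β [ w ]≔ c ,
        update-step β-proper β₁-proper w∈X (λ βw≡c → changed (trans (sym (β≈α w w≢v)) βw≡c)) ◅ ε ,
        shadow β₁-proper agree
        where
        fresh : ∀ {z} → z ∈ X → w ~ z → lookup β z ≢ c
        fresh {z} z∈X w~z with z ≟ v
        ... | yes refl = βv≢c
        ... | no z≢v   = λ βz≡c → apart α₁-proper w∈X-v (x∈p∧x≢y⇒x∈p-y z∈X z≢v) w~z
                           (sym (trans (sym (unchanged z (≢-sym (~⇒≢ w~z)))) (trans (sym (β≈α z z≢v)) βz≡c)))
        β₁-proper : ProperOn X (β [ w ]≔ c)
        β₁-proper = update-proper β-proper fresh
        agree : ∀ z → z ≢ v → lookup (β [ w ]≔ c) z ≡ lookup α₁ z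
        agree z z≢v with z ≟ w
        ... | yes refl = lookup∘update z β c
        ... | no z≢w   = trans (lookup∘update′ z≢w β c) (trans (β≈α z z≢v) (unchanged z z≢w))

      -- If v has colour c it blocks the step, so it first moves to a colour unused around it.
      lift-step : ∀ {β} → Shadow β α → Lift β α₁
      lift-step {β} shade with lookup β v ≟ c
      ... | no βv≢c  = recolour-w shade βv≢c
      ... | yes βv≡c =
        prepend (update-step β-proper β₂-proper v∈X (λ βv≡d → d≢c (trans (sym βv≡d) βv≡c)) ◅ ε)
                (recolour-w (shadow β₂-proper β₂≈α) (λ β₂v≡c → d≢c (trans (sym (lookup∘update v β d)) β₂v≡c)))
        where
        β-proper = Shadow.proper shade
        fresh = free-colour β c
        d = proj₁ fresh
        d≢c = proj₁ (proj₂ fresh)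
        β₂-proper : ProperOn X (β [ v ]≔ d)
        β₂-proper = update-proper β-proper λ z∈X v~z → proj₂ (proj₂ fresh) _ z∈X v~z
        β₂≈α : ∀ z → z ≢ v → lookup (β [ v ]≔ d) z ≡ lookup α z
        β₂≈α z z≢v = trans (lookup∘update′ z≢v β d) (Shadow.agrees shade z z≢v)

    lift : ∀ {α α′ β} → Star (Step (X - v)) α α′ → Shadow β α → Lift β α′
    lift ε shade = _ , ε , shade
    lift (step ◅ steps) shade with LiftStep.lift-step step shade
    ... | _ , steps₁ , shade₁ = prepend steps₁ (lift steps shade₁)

    module _ {δ γ β} (δ-proper : ProperOn X δ) (δ≈γ : ∀ z → z ≢ v → lookup δ z ≡ lookup γ z)
             (γ≈β : AgreeOn (X - v) γ β) (β-proper : ProperOn X β) where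
      private
        off-v : ∀ {z} → z ∈ X → z ≢ v → lookup δ z ≡ lookup β z
        off-v z∈X z≢v = trans (δ≈γ _ z≢v) (γ≈β (x∈p∧x≢y⇒x∈p-y z∈X z≢v))

        agree-if-at-v : ∀ δ′ → (∀ {z} → z ∈ X → z ≢ v → lookup δ′ z ≡ lookup β z) → lookup δ′ v ≡ lookup β v →
                        AgreeOn X δ′ β
        agree-if-at-v _ off at {z} z∈X with z ≟ v
        ... | yes refl = at
        ... | no z≢v   = off z∈X z≢v

        δ′-proper : ProperOn X (δ [ v ]≔ lookup β v)
        δ′-proper = update-proper δ-proper λ z∈X v~z δz≡βv →
          apart β-proper v∈X z∈X v~z (sym (trans (sym (off-v z∈X (≢-sym (~⇒≢ v~z)))) δz≡βv))

      fix-v : ∃ λ δ′ → Star (Step X) δ δ′ × AgreeOn X δ′ β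
      fix-v with lookup δ v ≟ lookup β v
      ... | yes δv≡βv = δ , ε , agree-if-at-v δ off-v δv≡βv
      ... | no δv≢βv  =
        δ [ v ]≔ lookup β v , update-step δ-proper δ′-proper v∈X δv≢βv ◅ ε ,
        agree-if-at-v (δ [ v ]≔ lookup β v)
          (λ {z} z∈X z≢v → trans (lookup∘update′ z≢v δ (lookup β v)) (off-v z∈X z≢v))
          (lookup∘update v δ (lookup β v))

    extend : Recolourable (X - v) → Recolourable X
    extend recolourable {α} {β} α-proper β-proper with recolourable (restrict α-proper) (restrict β-proper)
    ... | γ , steps , γ≈β with lift steps (shadow α-proper λ _ _ → refl)
    ...   | δ , steps′ , shadow δ-proper δ≈γ with fix-v {γ = γ} δ-proper δ≈γ γ≈β β-proper
    ...     | δ′ , steps″ , δ′≈β = δ′ , steps′ ◅◅ steps″ , δ′≈β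

  module _ {χ} (κ : Assignment Γ χ) (κ-proper : IsColoring Γ κ) (χ<ℓ : χ < ℓ)
           (simplicial-vertex : ∀ X → Nonempty X → ∃ λ s → s ∈ X × Simplicial X s) where

    recolourable : ∀ X → Acc _⊂_ X → Recolourable X
    recolourable X (acc smaller) {α} α-proper β-proper with nonempty? X
    ... | no empty = α , ε , λ z∈X → ⊥-elim (empty (_ , z∈X))
    ... | yes nonempty with simplicial-vertex X nonempty
    ...   | v , v∈X , simplicial =
      DeleteSimplicial.extend κ κ-proper χ<ℓ v∈X simplicial (recolourable (X - v) (smaller (x∈p⇒p-x⊂p v∈X)))
        α-proper β-proper

    connected : RConnected Γ ℓ
    connected α β α-proper β-proper =
      via-⊤ (recolourable ⊤ (⊂-wellFounded ⊤) {α} {β} (proper α-proper) (proper β-proper))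
      where
      proper : ∀ {α} → IsColoring Γ α → ProperOn ⊤ α
      proper α-proper = proper-on λ _ _ → α-proper _ _
      edge : ∀ {α β} → Step ⊤ α β → REdge Γ ℓ α β
      edge step =
        (λ _ _ → apart source-proper ∈⊤ ∈⊤) , (λ _ _ → apart target-proper ∈⊤ ∈⊤) , recoloured , changed , unchanged
        where open Step step
      via-⊤ : (∃ λ γ → Star (Step ⊤) α γ × AgreeOn ⊤ γ β) → Star (REdge Γ ℓ) α β
      via-⊤ (γ , steps , γ≈β) = subst (Star (REdge Γ ℓ) α) γ≡β (gmap id edge steps)
        where
        γ≡β : γ ≡ β
        γ≡β = trans (sym (tabulate∘lookup γ)) (trans (tabulate-cong λ _ → γ≈β ∈⊤) (tabulate∘lookup β))

lemma11 : (G H : Graph) → Chordal G → IsBlowupOf H G → Recolorable H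
lemma11 G H chordal blowup χ ((κ , κ-proper) , _) ℓ χ<ℓ =
  Recolouring.connected H κ κ-proper χ<ℓ (SimplicialVertices.simplicial-vertex H bypassFree)
  where
  holeFree : Holes.HoleFree H
  holeFree hole = Holes.chordal⇒holeFree G chordal (Blowup.project-hole blowup hole)
  bypassFree : ∀ {u M q} → ¬ Bypasses.Bypass H u M q
  bypassFree = Bypasses.holeFree⇒bypassFree H holeFree
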